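{- Let $G$ be a graph on $n$ nodes and let $k \in \left\{\left\lfloor \frac{n-1}{2}\right\rfloor, \left\lfloor \frac{n-1}{2}\right\rfloor+1, \ldots, n-2\right\}$ be an integer. A layout $\pi$ of $G$ satisfies $\beta_\pi(G) \le k$ if and only if $\{\pi^{ -1}(i), \pi^{ -1}(k+j+1)\} \notin E(G)$ for all integers $i, j$ with $0 \le i < n-k-1$ and $i \le j < n-k-1$.
   Context: Graphs are unweighted, undirected, finite, with no self-loops. A layout of a graph $G$ on $n$ nodes is a bijection $\pi : V(G) \to \{0,1,\ldots,n-1\}$. The layout bandwidth $\beta_\pi(G)$ is the minimum non-negative integer $k$ such that $|\pi(u)-\pi(v)| \le k$ for every edge $\{u,v\} \in E(G)$. -}

module Defs where

open import Level using (Level; _⊔_; suc)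
open import Data.Nat using (ℕ; _≤_; _<_; _∸_; _+_; ∣_-_∣)
open import Data.Fin using (Fin; toℕ)
open import Relation.Nullary using (¬_)
open import Relation.Binary.PropositionalEquality using (_≡_)

record Graph (n : ℕ) : Set₁ where
  field
    Edge     : Fin n → Fin n → Set
    sym      : ∀ {u v} → Edge u v → Edge v u
    irrefl   : ∀ {u} → ¬ Edge u u

open Graph public

-- A layout is a bijection V(G) = Fin n → {0,…,n-1} = Fin n; it is
-- given by the map π together with its two-sided inverse.
record Layout (n : ℕ) : Set where
  field
    π     : Fin n → Fin n
    π⁻¹   : Fin n → Fin n
    left  : ∀ v → π⁻¹ (π v) ≡ v
    right : ∀ i → π (π⁻¹ i) ≡ i

open Layout public

Stretch≤ : ∀ {n} → Graph n → Layout n → ℕ → Set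
Stretch≤ G L k = ∀ u v → Edge G u v → ∣ toℕ (π L u) - toℕ (π L v) ∣ ≤ k

IsLayoutBandwidth : ∀ {n} → Graph n → Layout n → ℕ → Set
IsLayoutBandwidth G L b = Stretch≤ G L b × (∀ k → Stretch≤ G L k → b ≤ k)
  where open import Data.Product using (_×_)

{-# OPTIONS --safe #-}
-- The pairs of positions (i, k + j + 1) with 0 ≤ i ≤ j < n - k - 1 are exactly
-- the pairs p < q in {0, …, n - 1} with q - p > k.  So the condition says that
-- no edge is stretched by more than k, which is β_π(G) ≤ k by minimality of the
-- bandwidth.
module Submission where

open import Defs
open import Data.Nat using (ℕ; _≤_; _<_; _∸_; _+_; _/_; suc; z<s; ∣_-_∣)
open import Data.Nat.Properties
open import Data.Nat.Tactic.RingSolver using (solve-∀)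
open import Data.Fin using (Fin; toℕ)
open import Data.Fin.Properties using (toℕ<n)
open import Data.Product using (_×_; _,_; ∃-syntax)
open import Data.Sum using (_⊎_; inj₁; inj₂; [_,_]′)
open import Function.Bundles using (_⇔_; mk⇔)
open import Function.Properties.Equivalence using () renaming (trans to ⇔-trans)
open import Relation.Nullary using (¬_)
open import Relation.Binary.PropositionalEquality as ≡ using (_≡_; refl; subst; subst₂)

k+m<n⇒k<∣m-n∣ : ∀ {k m n} → k + m < n → k < ∣ m - n ∣
k+m<n⇒k<∣m-n∣ {k} k+m<n =
  subst (k <_) (≡.sym (m≤n⇒∣m-n∣≡n∸m (m+n≤o⇒n≤o k (<⇒≤ k+m<n))))
    (m+n≤o⇒m≤o∸n (suc k) k+m<n)

k<∣m-n∣⇒k+m<n⊎k+n<m : ∀ {k m n} → k < ∣ m - n ∣ → k + m < n ⊎ k + n < m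
k<∣m-n∣⇒k+m<n⊎k+n<m {k} {m} {n} k<∣m-n∣ with ≤-total m n
... | inj₁ m≤n = inj₁ (m≤o∸n⇒m+n≤o (suc k) m≤n (subst (k <_) (m≤n⇒∣m-n∣≡n∸m m≤n) k<∣m-n∣))
... | inj₂ n≤m = inj₂ (m≤o∸n⇒m+n≤o (suc k) n≤m (subst (k <_) (m≤n⇒∣n-m∣≡n∸m n≤m) k<∣m-n∣))

k+j+1<n⇒j<n∸k∸1 : ∀ {k j n} → k + j + 1 < n → j < n ∸ k ∸ 1
k+j+1<n⇒j<n∸k∸1 {k} {j} {n} k+j+1<n =
  m+n≤o⇒m≤o∸n (suc j) (m+n≤o⇒m≤o∸n (suc j + 1) (subst (_≤ n) (reorder k j) k+j+1<n))
  where
  reorder : ∀ k j → suc (k + j + 1) ≡ suc j + 1 + k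
  reorder = solve-∀

long-pair-offset : ∀ {k p q n} → k + p < q → q < n
  → ∃[ j ] p ≤ j × j < n ∸ k ∸ 1 × q ≡ k + j + 1
long-pair-offset {k} {p} {n = n} k+p<q q<n with m≤n⇒∃[o]m+o≡n k+p<q
... | d , refl =
  p + d , m≤m+n p d , k+j+1<n⇒j<n∸k∸1 {k} (subst (_< n) (reorder k p d) q<n) , reorder k p d
  where
  reorder : ∀ k p d → suc (k + p) + d ≡ k + (p + d) + 1
  reorder = solve-∀

module _ {n : ℕ} (G : Graph n) (L : Layout n) where

  bandwidth≤⇔stretch≤ : ∀ {b k} → IsLayoutBandwidth G L b → (b ≤ k ⇔ Stretch≤ G L k)
  bandwidth≤⇔stretch≤ (stretch≤b , minimal) =
    mk⇔ (λ b≤k u v e → ≤-trans (stretch≤b u v e) b≤k) (minimal _)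

  NoLongEdges : ℕ → Set
  NoLongEdges k = ∀ p q → k + toℕ p < toℕ q → ¬ Edge G (π⁻¹ L p) (π⁻¹ L q)

  NoLongEdgesByOffset : ℕ → Set
  NoLongEdgesByOffset k = ∀ (i : ℕ) (j : ℕ) (a c : Fin n)
    → i < n ∸ k ∸ 1 → i ≤ j → j < n ∸ k ∸ 1
    → toℕ a ≡ i → toℕ c ≡ k + j + 1
    → ¬ Edge G (π⁻¹ L a) (π⁻¹ L c)

  stretch≤⇔noLongEdges : ∀ {k} → Stretch≤ G L k ⇔ NoLongEdges k
  stretch≤⇔noLongEdges {k} = mk⇔ to from
    where
    to : Stretch≤ G L k → NoLongEdges k
    to stretch≤ p q k+p<q e = <⇒≱ (k+m<n⇒k<∣m-n∣ k+p<q)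
      (subst₂ (λ a c → ∣ toℕ a - toℕ c ∣ ≤ k) (right L p) (right L q) (stretch≤ _ _ e))

    from : NoLongEdges k → Stretch≤ G L k
    from noLong u v e = ≮⇒≥ λ k<stretch →
      [ (λ u-before-v → noEdge u v u-before-v e)
      , (λ v-before-u → noEdge v u v-before-u (Graph.sym G e))
      ]′ (k<∣m-n∣⇒k+m<n⊎k+n<m k<stretch)
      where
      noEdge : ∀ u v → k + toℕ (π L u) < toℕ (π L v) → ¬ Edge G u v
      noEdge u v far e = noLong (π L u) (π L v) far
        (subst₂ (Edge G) (≡.sym (left L u)) (≡.sym (left L v)) e)

  noLongEdges⇔byOffset : ∀ {k} → NoLongEdges k ⇔ NoLongEdgesByOffset k
  noLongEdges⇔byOffset {k} = mk⇔ to from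
    where
    to : NoLongEdges k → NoLongEdgesByOffset k
    to noLong i j a c _ i≤j _ refl c≡k+j+1 = noLong a c
      (subst (k + i <_) (≡.sym c≡k+j+1) (≤-<-trans (+-monoʳ-≤ k i≤j) (m<m+n (k + j) z<s)))

    from : NoLongEdgesByOffset k → NoLongEdges k
    from byOffset p q k+p<q with long-pair-offset k+p<q (toℕ<n q)
    ... | j , p≤j , j<bound , q≡k+j+1 =
      byOffset (toℕ p) j p q (≤-<-trans p≤j j<bound) p≤j j<bound refl q≡k+j+1

lemma3p1 : (n : ℕ) (G : Graph n) (k : ℕ)
    → (n ∸ 1) / 2 ≤ k → k + 2 ≤ n
    → (L : Layout n) (b : ℕ) → IsLayoutBandwidth G L b
    → (b ≤ k) ⇔ (∀ (i : ℕ) (j : ℕ) (a c : Fin n)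
                   → i < n ∸ k ∸ 1 → i ≤ j → j < n ∸ k ∸ 1
                   → toℕ a ≡ i → toℕ c ≡ k + j + 1
                   → ¬ Edge G (π⁻¹ L a) (π⁻¹ L c))
lemma3p1 n G k _ _ L b bandwidth =
  ⇔-trans (bandwidth≤⇔stretch≤ G L bandwidth)
    (⇔-trans (stretch≤⇔noLongEdges G L) (noLongEdges⇔byOffset G L))
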